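{- Let $G=(V,E)$ be a finite simple undirected graph and let $S\subseteq V$ be such that the connected components of $G-S$ are $C_1,\ldots,C_p$, each of which is a $2$-club. Let $S'\subseteq S$ be such that the closed neighborhoods $N[s]$, $s\in S'$, are pairwise disjoint, and put $U=S\setminus N[S']$. Assume that $V(C_i)\not\subseteq N[S']$ for every $i\in[1,p]$. Then a set $D\subseteq V$ is an efficient dominating set of $G$ with $D\cap S=S'$ if and only if there exists $(v_1,\ldots,v_p)\in V(C_1)\times\cdots\times V(C_p)$ such that: (1) $D=S'\cup\{v_1,\ldots,v_p\}$, where this union is disjoint; (2) the sets $N[v_i]\cap U$, $i\in[1,p]$, are pairwise disjoint and their union is $U$; (3) for every $i\in[1,p]$, $V(C_i)\subseteq N[v_i]\cup N[S']$ and $N[v_i]\cap N[S']=\emptyset$.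
   Context: All neighborhoods are taken in $G$: $N[v]=\{v\}\cup\{w: vw\in E\}$ is the closed neighborhood and $N[X]=\bigcup_{x\in X}N[x]$. A $2$-club is a graph in which every two vertices are at distance at most $2$. A set $D\subseteq V$ is an efficient dominating set (EDS) of $G$ if $|N[v]\cap D|=1$ for every $v\in V$. $[1,p]=\{1,\ldots,p\}$. -}

module Defs where

open import Data.Nat using (ℕ)
open import Data.Fin using (Fin; _≟_)
open import Data.Fin.Subset using (Subset; _∈_; _∉_; _∩_; ⋃; ⁅_⁆; Nonempty; _⊆_)
open import Data.Fin.Subset.Properties using (_∈?_)
open import Data.Bool using (_∨_)
open import Data.List using (List; map; filter)
open import Data.List.Base using (allFin)
open import Data.Vec using (tabulate)
open import Data.Product using (Σ; ∃; _×_)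
open import Data.Sum using (_⊎_)
open import Relation.Nullary using (¬_; does)
open import Relation.Binary using (Rel; Decidable; Symmetric; Irreflexive)
open import Relation.Binary.PropositionalEquality using (_≡_)
open import Level using (0ℓ)

record Graph (n : ℕ) : Set₁ where
  field
    _~_     : Rel (Fin n) 0ℓ
    ~-dec   : Decidable _~_
    ~-sym   : Symmetric _~_
    ~-irref : Irreflexive _≡_ _~_

module _ {n : ℕ} (G : Graph n) where
  open Graph G

  N[_] : Fin n → Subset n
  N[ v ] = tabulate λ w → does (w ≟ v) ∨ does (~-dec v w)

  N⟦_⟧ : Subset n → Subset n
  N⟦ X ⟧ = ⋃ (map N[_] (filter (_∈? X) (allFin n)))

  data Reach (X : Subset n) : Fin n → Fin n → Set where
    here : ∀ {x} → x ∈ X → Reach X x x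
    step : ∀ {x y z} → Reach X x y → y ~ z → z ∈ X → Reach X x z

  record IsComponent (X C : Subset n) : Set where
    field
      nonempty  : Nonempty C
      inside    : C ⊆ X
      connected : ∀ {x y} → x ∈ C → y ∈ C → Reach X x y
      closed    : ∀ {x y} → x ∈ C → y ∈ X → x ~ y → y ∈ C

  record AreComponents (X : Subset n) {p : ℕ} (C : Fin p → Subset n) : Set where
    field
      component : ∀ i → IsComponent X (C i)
      distinct  : ∀ i j → ¬ (i ≡ j) → ¬ Nonempty (C i ∩ C j)
      cover     : ∀ {x} → x ∈ X → ∃ λ i → x ∈ C i

  IsTwoClub : Subset n → Set
  IsTwoClub C = ∀ {x y} → x ∈ C → y ∈ C →
    x ≡ y ⊎ x ~ y ⊎ (∃ λ z → z ∈ C × x ~ z × z ~ y)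

  IsEDS : Subset n → Set
  IsEDS D = ∀ v → Data.Fin.Subset.∣ N[ v ] ∩ D ∣ ≡ 1

image : ∀ {n p} → (Fin p → Fin n) → Subset n
image {p = p} v = ⋃ (map (λ i → ⁅ v i ⁆) (allFin p))

-- In an efficient dominating set D with D ∩ S = S′, each component C_i contains a
-- vertex outside N[S′]; its unique dominator lies outside S, hence in C_i. Two
-- vertices of D in the 2-club C_i have a common closed neighbour, so they coincide:
-- D = S′ ⊎ {v₁,…,v_p}, and (2), (3) say that every vertex of U, of N[S′] and of
-- each C_i has exactly one dominator. Conversely (1)–(3) give every vertex a
-- dominator, and it is unique because S′ is a packing, N[v_i] misses N[S′], and
-- two distinct v_i have no common neighbour.
module Submission where

open import Defs
open import Data.Bool using (Bool; true)
open import Data.Fin using (Fin; _≟_)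
open import Data.Fin.Properties using (¬∀⟶∃¬)
open import Data.Fin.Subset
  using (Subset; _∈_; _∉_; _∩_; _∪_; _─_; _-_; ∁; ⋃; ⁅_⁆; ∣_∣; inside; outside; Nonempty; _⊆_)
open import Data.Fin.Subset.Properties
open import Data.List using (List; []; _∷_; map; filter)
open import Data.List.Base using (allFin)
open import Data.List.Membership.Propositional using (find; lose)
open import Data.List.Membership.Propositional.Properties using (∈-allFin; ∈-filter⁺; ∈-filter⁻)
open import Data.List.Relation.Unary.Any as Any using (Any; satisfied)
open import Data.List.Relation.Unary.Any.Properties using (map⁺; map⁻)
open import Data.Nat using (ℕ; _≤_; _<_)
open import Data.Nat.Properties using (n<1⇒n≡0; <⇒≢)
open import Data.Product using (Σ; ∃; _×_; _,_; proj₁; proj₂)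
open import Data.Sum using (_⊎_; inj₁; inj₂)
open import Data.Vec using (_∷_; here; there; tabulate)
open import Data.Vec.Properties using ([]=⇒lookup; lookup⇒[]=; lookup∘tabulate)
open import Function using (_∘_)
open import Function.Bundles using (_⇔_; mk⇔; Equivalence)
open import Relation.Nullary using (¬_; Dec; yes; no; does; contradiction)
open import Relation.Nullary.Decidable using (dec-true; _⊎-dec_; _→-dec_)
open import Relation.Binary.PropositionalEquality using (_≡_; _≢_; refl; sym; trans; cong; subst)

private
  variable
    n p : ℕ
    x y : Fin n
    P Q : Subset n

does≡true⇒ : ∀ {A : Set} (a? : Dec A) → does a? ≡ true → A
does≡true⇒ (yes a) _ = a

∈tabulate⇔ : ∀ {f : Fin n → Bool} {x} → x ∈ tabulate f ⇔ f x ≡ true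
∈tabulate⇔ {f = f} {x} = mk⇔
  (λ x∈ → trans (sym (lookup∘tabulate f x)) ([]=⇒lookup x∈))
  (λ fx≡true → lookup⇒[]= x (tabulate f) (trans (lookup∘tabulate f x) fx≡true))

x∈p─q⇒x∉q : x ∈ P ─ Q → x ∉ Q
x∈p─q⇒x∉q {P = _ ∷ P} {Q = outside ∷ Q} (there x∈) (there x∈Q) = x∈p─q⇒x∉q x∈ x∈Q
x∈p─q⇒x∉q {P = _ ∷ P} {Q = inside ∷ Q} (there x∈) (there x∈Q) = x∈p─q⇒x∉q x∈ x∈Q

p⊈q⇒∃∉ : ¬ P ⊆ Q → ∃ λ x → x ∈ P × x ∉ Q
p⊈q⇒∃∉ {n} {P} {Q} P⊈Q
  with ¬∀⟶∃¬ n (λ x → x ∈ P → x ∈ Q) (λ x → (x ∈? P) →-dec (x ∈? Q)) (λ ∀x → P⊈Q (∀x _))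
... | x , x∉ with x ∈? P
...   | yes x∈P = x , x∈P , λ x∈Q → x∉ (λ _ → x∈Q)
...   | no  x∉P = contradiction (λ x∈P → contradiction x∈P x∉P) x∉

x∈p⇒⁅x⁆⊆p : x ∈ P → ⁅ x ⁆ ⊆ P
x∈p⇒⁅x⁆⊆p {P = P} x∈P y∈⁅x⁆ = subst (_∈ P) (sym (x∈⁅y⁆⇒x≡y _ y∈⁅x⁆)) x∈P

x∈p⇒0<∣p∣ : x ∈ P → 0 < ∣ P ∣
x∈p⇒0<∣p∣ {x = x} x∈P = subst (_≤ _) (∣⁅x⁆∣≡1 x) (p⊆q⇒∣p∣≤∣q∣ (x∈p⇒⁅x⁆⊆p x∈P))

∣p∣≡1⇒Nonempty : ∣ P ∣ ≡ 1 → Nonempty P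
∣p∣≡1⇒Nonempty {n} {P} ∣P∣≡1 with nonempty? P
... | yes ne    = ne
... | no  empty = contradiction (trans (sym (cong ∣_∣ (Empty-unique empty))) ∣P∣≡1)
                                (subst (_≢ 1) (sym (∣⊥∣≡0 n)) λ ())

∣p∣≡1⇒x≡y : ∣ P ∣ ≡ 1 → x ∈ P → y ∈ P → x ≡ y
∣p∣≡1⇒x≡y {P = P} {x} {y} ∣P∣≡1 x∈P y∈P with x ≟ y
... | yes x≡y = x≡y
... | no  x≢y = contradiction (n<1⇒n≡0 ∣P-x∣<1) (<⇒≢ (x∈p⇒0<∣p∣ y∈P-x) ∘ sym)
  where
  y∈P-x : y ∈ P - x
  y∈P-x = x∈p∧x≢y⇒x∈p-y y∈P (x≢y ∘ sym)
  ∣P-x∣<1 : ∣ P - x ∣ < 1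
  ∣P-x∣<1 = subst (∣ P - x ∣ <_) ∣P∣≡1 (x∈p⇒∣p-x∣<∣p∣ x∈P)

∣p∣≡1⁺ : x ∈ P → (∀ {y} → y ∈ P → y ≡ x) → ∣ P ∣ ≡ 1
∣p∣≡1⁺ {x = x} x∈P unique =
  trans (cong ∣_∣ (⊆-antisym (λ y∈P → subst (_∈ ⁅ x ⁆) (sym (unique y∈P)) (x∈⁅x⁆ x))
                             (x∈p⇒⁅x⁆⊆p x∈P)))
        (∣⁅x⁆∣≡1 x)

x∈⋃⁻ : ∀ (Ps : List (Subset n)) → x ∈ ⋃ Ps → Any (x ∈_) Ps
x∈⋃⁻ (P ∷ Ps) x∈ with x∈p∪q⁻ P (⋃ Ps) x∈
... | inj₁ x∈P  = Any.here x∈P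
... | inj₂ x∈Ps = Any.there (x∈⋃⁻ Ps x∈Ps)
x∈⋃⁻ [] x∈⊥ = contradiction x∈⊥ ∉⊥

x∈⋃⁺ : ∀ {Ps : List (Subset n)} → Any (x ∈_) Ps → x ∈ ⋃ Ps
x∈⋃⁺ (Any.here x∈P)   = x∈p∪q⁺ (inj₁ x∈P)
x∈⋃⁺ (Any.there x∈Ps) = x∈p∪q⁺ (inj₂ (x∈⋃⁺ x∈Ps))

module _ {p} (F : Fin p → Subset n) where

  x∈⋃-allFin⁻ : x ∈ ⋃ (map F (allFin p)) → ∃ λ i → x ∈ F i
  x∈⋃-allFin⁻ = satisfied ∘ map⁻ ∘ x∈⋃⁻ (map F (allFin p))

  x∈⋃-allFin⁺ : ∀ i → x ∈ F i → x ∈ ⋃ (map F (allFin p))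
  x∈⋃-allFin⁺ i x∈Fi = x∈⋃⁺ (map⁺ (lose (∈-allFin i) x∈Fi))

x∈image⁻ : ∀ (v : Fin p → Fin n) → x ∈ image v → ∃ λ i → x ≡ v i
x∈image⁻ v x∈ with x∈⋃-allFin⁻ (λ i → ⁅ v i ⁆) x∈
... | i , x∈⁅vi⁆ = i , x∈⁅y⁆⇒x≡y (v i) x∈⁅vi⁆

vi∈image : ∀ (v : Fin p → Fin n) i → v i ∈ image v
vi∈image v i = x∈⋃-allFin⁺ (λ i → ⁅ v i ⁆) i (x∈⁅x⁆ (v i))

module _ (G : Graph n) where
  open Graph G

  private
    N : Fin n → Subset n
    N = N[_] G

  ∈N[]⁻ : ∀ {v} → x ∈ N v → x ≡ v ⊎ v ~ x
  ∈N[]⁻ {x = x} {v} = does≡true⇒ ((x ≟ v) ⊎-dec ~-dec v x) ∘ Equivalence.to ∈tabulate⇔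

  ∈N[]⁺ : ∀ {v} → x ≡ v ⊎ v ~ x → x ∈ N v
  ∈N[]⁺ {x = x} {v} = Equivalence.from ∈tabulate⇔ ∘ dec-true ((x ≟ v) ⊎-dec ~-dec v x)

  v∈N[v] : ∀ v → v ∈ N v
  v∈N[v] v = ∈N[]⁺ (inj₁ refl)

  ∈N[]-sym : x ∈ N y → y ∈ N x
  ∈N[]-sym x∈N[y] with ∈N[]⁻ x∈N[y]
  ... | inj₁ refl = v∈N[v] _
  ... | inj₂ y~x  = ∈N[]⁺ (inj₂ (~-sym y~x))

  ∈N⟦⟧⁻ : ∀ {X} → x ∈ N⟦_⟧ G X → ∃ λ s → s ∈ X × x ∈ N s
  ∈N⟦⟧⁻ {X = X} x∈ with find (map⁻ (x∈⋃⁻ (map N (filter (_∈? X) (allFin n))) x∈))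
  ... | s , s∈ , x∈N[s] = s , proj₂ (∈-filter⁻ (_∈? X) {xs = allFin n} s∈) , x∈N[s]

  ∈N⟦⟧⁺ : ∀ {X s} → s ∈ X → x ∈ N s → x ∈ N⟦_⟧ G X
  ∈N⟦⟧⁺ {X = X} s∈X x∈N[s] =
    x∈⋃⁺ (map⁺ (lose (∈-filter⁺ (_∈? X) {xs = allFin n} (∈-allFin _) s∈X) x∈N[s]))

  module _ {D : Subset n} (eds : IsEDS G D) where

    IsEDS⇒dominator : ∀ w → ∃ λ d → d ∈ N w × d ∈ D
    IsEDS⇒dominator w with ∣p∣≡1⇒Nonempty (eds w)
    ... | d , d∈ = d , x∈p∩q⁻ _ _ d∈

    IsEDS⇒dominator-unique : ∀ {w a b} → a ∈ N w → a ∈ D → b ∈ N w → b ∈ D → a ≡ b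
    IsEDS⇒dominator-unique a∈N a∈D b∈N b∈D =
      ∣p∣≡1⇒x≡y (eds _) (x∈p∩q⁺ (a∈N , a∈D)) (x∈p∩q⁺ (b∈N , b∈D))

    -- Two vertices of a 2-club are at distance at most 2, so both dominate some common vertex.
    IsEDS⇒twoClub-meets-once : ∀ {C a b} → IsTwoClub G C →
      a ∈ C → b ∈ C → a ∈ D → b ∈ D → a ≡ b
    IsEDS⇒twoClub-meets-once twoClub a∈C b∈C a∈D b∈D with twoClub a∈C b∈C
    ... | inj₁ a≡b = a≡b
    ... | inj₂ (inj₁ a~b) =
      IsEDS⇒dominator-unique (v∈N[v] _) a∈D (∈N[]⁺ (inj₂ a~b)) b∈D
    ... | inj₂ (inj₂ (z , _ , a~z , z~b)) =
      IsEDS⇒dominator-unique (∈N[]⁺ (inj₂ (~-sym a~z))) a∈D (∈N[]⁺ (inj₂ z~b)) b∈D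

  dominator-unique⇒IsEDS : ∀ {D} → (∀ w → ∃ λ d → d ∈ N w × d ∈ D) →
    (∀ {w a b} → a ∈ N w → a ∈ D → b ∈ N w → b ∈ D → a ≡ b) → IsEDS G D
  dominator-unique⇒IsEDS dominator unique w with dominator w
  ... | d , d∈N , d∈D =
    ∣p∣≡1⁺ (x∈p∩q⁺ (d∈N , d∈D)) λ {y} y∈ → let y∈N , y∈D = x∈p∩q⁻ _ _ y∈ in unique y∈N y∈D d∈N d∈D

  IsComponent-N-closed : ∀ {X C} → IsComponent G X C → x ∈ C → y ∈ X → y ∈ N x → y ∈ C
  IsComponent-N-closed component x∈C y∈X y∈N[x] with ∈N[]⁻ y∈N[x]
  ... | inj₁ refl = x∈C
  ... | inj₂ x~y  = IsComponent.closed component x∈C y∈X x~y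

  AreComponents-unique : ∀ {X p} {C : Fin p → Subset n} → AreComponents G X C →
    ∀ {i j} → x ∈ C i → x ∈ C j → i ≡ j
  AreComponents-unique components {i = i} {j} x∈Ci x∈Cj with i ≟ j
  ... | yes i≡j = i≡j
  ... | no  i≢j = contradiction (_ , x∈p∩q⁺ (x∈Ci , x∈Cj)) (AreComponents.distinct components i j i≢j)

module _ (G : Graph n) (S S′ : Subset n) (C : Fin p → Subset n)
         (components : AreComponents G (∁ S) C) (S′⊆S : S′ ⊆ S) where

  private
    N : Fin n → Subset n
    N = N[_] G
    N[S′] : Subset n
    N[S′] = N⟦_⟧ G S′
    U : Subset n
    U = S ─ N[S′]

  ∈C⇒∉S : ∀ {i} → x ∈ C i → x ∉ S
  ∈C⇒∉S {i = i} = x∈∁p⇒x∉p ∘ IsComponent.inside (AreComponents.component components i)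

  ∈C-N-closed : ∀ {i} → x ∈ C i → y ∉ S → y ∈ N x → y ∈ C i
  ∈C-N-closed {i = i} x∈Ci y∉S =
    IsComponent-N-closed G (AreComponents.component components i) x∈Ci (x∉p⇒x∈∁p y∉S)

  module Necessity (twoClub : ∀ i → IsTwoClub G (C i)) (C⊈N[S′] : ∀ i → ¬ C i ⊆ N[S′])
                   {D : Subset n} (eds : IsEDS G D) (D∩S≡S′ : D ∩ S ≡ S′) where

    ∈D∩S⇒∈S′ : x ∈ D → x ∈ S → x ∈ S′
    ∈D∩S⇒∈S′ {x = x} x∈D x∈S = subst (x ∈_) D∩S≡S′ (x∈p∩q⁺ (x∈D , x∈S))

    S′⊆D : S′ ⊆ D
    S′⊆D {x} x∈S′ = proj₁ (x∈p∩q⁻ D S (subst (x ∈_) (sym D∩S≡S′) x∈S′))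

    opaque
      C-meets-D : ∀ i → ∃ λ d → d ∈ C i × d ∈ D
      C-meets-D i with p⊈q⇒∃∉ (C⊈N[S′] i)
      ... | x , x∈Ci , x∉N[S′] with IsEDS⇒dominator G eds x
      ... | d , d∈N[x] , d∈D with d ∈? S
      ... | yes d∈S = contradiction (∈N⟦⟧⁺ G (∈D∩S⇒∈S′ d∈D d∈S) (∈N[]-sym G d∈N[x])) x∉N[S′]
      ... | no  d∉S = d , ∈C-N-closed x∈Ci d∉S d∈N[x] , d∈D

    v : Fin p → Fin n
    v = proj₁ ∘ C-meets-D

    v∈C : ∀ i → v i ∈ C i
    v∈C = proj₁ ∘ proj₂ ∘ C-meets-D

    v∈D : ∀ i → v i ∈ D
    v∈D = proj₂ ∘ proj₂ ∘ C-meets-D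

    ∈D∩C⇒≡v : ∀ {i} → x ∈ D → x ∈ C i → x ≡ v i
    ∈D∩C⇒≡v {i = i} x∈D x∈Ci = IsEDS⇒twoClub-meets-once G eds (twoClub i) x∈Ci (v∈C i) x∈D (v∈D i)

    ∈D-split : x ∈ D → x ∈ S′ ⊎ ∃ λ i → x ≡ v i
    ∈D-split {x = x} x∈D with x ∈? S
    ... | yes x∈S = inj₁ (∈D∩S⇒∈S′ x∈D x∈S)
    ... | no  x∉S = let i , x∈Ci = AreComponents.cover components (x∉p⇒x∈∁p x∉S)
                    in inj₂ (i , ∈D∩C⇒≡v x∈D x∈Ci)

    D≡S′∪image : D ≡ S′ ∪ image v
    D≡S′∪image = ⊆-antisym D⊆ ⊆D
      where
      D⊆ : D ⊆ S′ ∪ image v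
      D⊆ x∈D with ∈D-split x∈D
      ... | inj₁ x∈S′       = x∈p∪q⁺ (inj₁ x∈S′)
      ... | inj₂ (i , refl) = x∈p∪q⁺ (inj₂ (vi∈image v i))
      ⊆D : S′ ∪ image v ⊆ D
      ⊆D x∈ with x∈p∪q⁻ S′ (image v) x∈
      ... | inj₁ x∈S′ = S′⊆D x∈S′
      ... | inj₂ x∈image with x∈image⁻ v x∈image
      ...   | i , refl = v∈D i

    S′∩image-empty : ¬ Nonempty (S′ ∩ image v)
    S′∩image-empty (x , x∈) with x∈p∩q⁻ S′ (image v) x∈
    ... | x∈S′ , x∈image with x∈image⁻ v x∈image
    ...   | i , refl = ∈C⇒∉S (v∈C i) (S′⊆S x∈S′)

    v-injective : ∀ i j → v i ≡ v j → i ≡ j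
    v-injective i j vi≡vj = AreComponents-unique G components (v∈C i) (subst (_∈ C j) (sym vi≡vj) (v∈C j))

    N[v]∩U-disjoint : ∀ i j → ¬ i ≡ j → ¬ Nonempty ((N (v i) ∩ U) ∩ (N (v j) ∩ U))
    N[v]∩U-disjoint i j i≢j (x , x∈) =
      let x∈N[vi]∩U , x∈N[vj]∩U = x∈p∩q⁻ _ _ x∈
          vi∈N[x] = ∈N[]-sym G (proj₁ (x∈p∩q⁻ _ _ x∈N[vi]∩U))
          vj∈N[x] = ∈N[]-sym G (proj₁ (x∈p∩q⁻ _ _ x∈N[vj]∩U))
      in i≢j (v-injective i j (IsEDS⇒dominator-unique G eds vi∈N[x] (v∈D i) vj∈N[x] (v∈D j)))

    ⋃N[v]∩U≡U : ⋃ (map (λ i → N (v i) ∩ U) (allFin p)) ≡ U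
    ⋃N[v]∩U≡U = ⊆-antisym ⋃⊆U U⊆⋃
      where
      ⋃⊆U : ⋃ (map (λ i → N (v i) ∩ U) (allFin p)) ⊆ U
      ⋃⊆U x∈ = let _ , x∈N[vi]∩U = x∈⋃-allFin⁻ (λ i → N (v i) ∩ U) x∈ in proj₂ (x∈p∩q⁻ _ _ x∈N[vi]∩U)
      U⊆⋃ : U ⊆ ⋃ (map (λ i → N (v i) ∩ U) (allFin p))
      U⊆⋃ {x} x∈U with IsEDS⇒dominator G eds x
      ... | d , d∈N[x] , d∈D with ∈D-split d∈D
      ... | inj₁ d∈S′       = contradiction (∈N⟦⟧⁺ G d∈S′ (∈N[]-sym G d∈N[x])) (x∈p─q⇒x∉q x∈U)
      ... | inj₂ (i , refl) = x∈⋃-allFin⁺ (λ i → N (v i) ∩ U) i (x∈p∩q⁺ (∈N[]-sym G d∈N[x] , x∈U))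

    C⊆N[v]∪N[S′] : ∀ i → C i ⊆ N (v i) ∪ N[S′]
    C⊆N[v]∪N[S′] i {x} x∈Ci with IsEDS⇒dominator G eds x
    ... | d , d∈N[x] , d∈D with ∈D-split d∈D
    ... | inj₁ d∈S′       = x∈p∪q⁺ (inj₂ (∈N⟦⟧⁺ G d∈S′ (∈N[]-sym G d∈N[x])))
    ... | inj₂ (j , refl) =
      x∈p∪q⁺ (inj₁ (subst (λ u → x ∈ N u) (∈D∩C⇒≡v d∈D (∈C-N-closed x∈Ci (∈C⇒∉S (v∈C j)) d∈N[x]))
                          (∈N[]-sym G d∈N[x])))

    N[v]∩N[S′]-empty : ∀ i → ¬ Nonempty (N (v i) ∩ N[S′])
    N[v]∩N[S′]-empty i (x , x∈) with x∈p∩q⁻ _ _ x∈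
    ... | x∈N[vi] , x∈N[S′] with ∈N⟦⟧⁻ G x∈N[S′]
    ...   | s , s∈S′ , x∈N[s] =
      let s≡vi = IsEDS⇒dominator-unique G eds (∈N[]-sym G x∈N[s]) (S′⊆D s∈S′) (∈N[]-sym G x∈N[vi]) (v∈D i)
      in ∈C⇒∉S (v∈C i) (subst (_∈ S) s≡vi (S′⊆S s∈S′))

  module Sufficiency
    (packing : ∀ {s t} → s ∈ S′ → t ∈ S′ → ¬ s ≡ t → ¬ Nonempty (N s ∩ N t))
    {D : Subset n} (v : Fin p → Fin n) (v∈C : ∀ i → v i ∈ C i) (D≡S′∪image : D ≡ S′ ∪ image v)
    (N[v]∩U-disjoint : ∀ i j → ¬ i ≡ j → ¬ Nonempty ((N (v i) ∩ U) ∩ (N (v j) ∩ U)))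
    (⋃N[v]∩U≡U : ⋃ (map (λ i → N (v i) ∩ U) (allFin p)) ≡ U)
    (C-dominated : ∀ i → C i ⊆ N (v i) ∪ N[S′] × ¬ Nonempty (N (v i) ∩ N[S′])) where

    ∈D-split : x ∈ D → x ∈ S′ ⊎ ∃ λ i → x ≡ v i
    ∈D-split {x = x} x∈D with x∈p∪q⁻ S′ (image v) (subst (x ∈_) D≡S′∪image x∈D)
    ... | inj₁ x∈S′    = inj₁ x∈S′
    ... | inj₂ x∈image = inj₂ (x∈image⁻ v x∈image)

    S′⊆D : S′ ⊆ D
    S′⊆D {x} x∈S′ = subst (x ∈_) (sym D≡S′∪image) (x∈p∪q⁺ (inj₁ x∈S′))

    v∈D : ∀ i → v i ∈ D
    v∈D i = subst (v i ∈_) (sym D≡S′∪image) (x∈p∪q⁺ (inj₂ (vi∈image v i)))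

    D∩S≡S′ : D ∩ S ≡ S′
    D∩S≡S′ = ⊆-antisym D∩S⊆S′ (λ x∈S′ → x∈p∩q⁺ (S′⊆D x∈S′ , S′⊆S x∈S′))
      where
      D∩S⊆S′ : D ∩ S ⊆ S′
      D∩S⊆S′ x∈ with x∈p∩q⁻ D S x∈
      ... | x∈D , x∈S with ∈D-split x∈D
      ...   | inj₁ x∈S′       = x∈S′
      ...   | inj₂ (i , refl) = contradiction x∈S (∈C⇒∉S (v∈C i))

    ∈N[v]⇒∉N[S′] : ∀ {i} → x ∈ N (v i) → x ∉ N[S′]
    ∈N[v]⇒∉N[S′] {i = i} x∈N[vi] x∈N[S′] = proj₂ (C-dominated i) (_ , x∈p∩q⁺ (x∈N[vi] , x∈N[S′]))

    -- A common neighbour lies either in a single component or in U.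
    common-neighbour⇒≡ : ∀ {i j w} → w ∈ N (v i) → w ∈ N (v j) → i ≡ j
    common-neighbour⇒≡ {i} {j} {w} w∈N[vi] w∈N[vj] with i ≟ j | w ∈? S
    ... | yes i≡j | _       = i≡j
    ... | no  i≢j | no  w∉S =
      AreComponents-unique G components (∈C-N-closed (v∈C i) w∉S w∈N[vi]) (∈C-N-closed (v∈C j) w∉S w∈N[vj])
    ... | no  i≢j | yes w∈S =
      let w∈U = x∈p∧x∉q⇒x∈p─q w∈S (∈N[v]⇒∉N[S′] w∈N[vi])
      in contradiction (w , x∈p∩q⁺ (x∈p∩q⁺ (w∈N[vi] , w∈U) , x∈p∩q⁺ (w∈N[vj] , w∈U))) (N[v]∩U-disjoint i j i≢j)

    dominator : ∀ w → ∃ λ d → d ∈ N w × d ∈ D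
    dominator w with w ∈? N[S′] | w ∈? S
    ... | yes w∈N[S′] | _ = let s , s∈S′ , w∈N[s] = ∈N⟦⟧⁻ G w∈N[S′] in s , ∈N[]-sym G w∈N[s] , S′⊆D s∈S′
    ... | no  w∉N[S′] | yes w∈S =
      let i , w∈N[vi]∩U = x∈⋃-allFin⁻ (λ i → N (v i) ∩ U)
                            (subst (w ∈_) (sym ⋃N[v]∩U≡U) (x∈p∧x∉q⇒x∈p─q w∈S w∉N[S′]))
      in v i , ∈N[]-sym G (proj₁ (x∈p∩q⁻ _ _ w∈N[vi]∩U)) , v∈D i
    ... | no  w∉N[S′] | no  w∉S with AreComponents.cover components (x∉p⇒x∈∁p w∉S)
    ...   | i , w∈Ci with x∈p∪q⁻ (N (v i)) N[S′] (proj₁ (C-dominated i) w∈Ci)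
    ...     | inj₁ w∈N[vi]  = v i , ∈N[]-sym G w∈N[vi] , v∈D i
    ...     | inj₂ w∈N[S′]  = contradiction w∈N[S′] w∉N[S′]

    dominator-unique : ∀ {w a b} → a ∈ N w → a ∈ D → b ∈ N w → b ∈ D → a ≡ b
    dominator-unique {w} {a} {b} a∈N[w] a∈D b∈N[w] b∈D with ∈D-split a∈D | ∈D-split b∈D
    ... | inj₁ a∈S′ | inj₁ b∈S′ with a ≟ b
    ...   | yes a≡b = a≡b
    ...   | no  a≢b = contradiction (w , x∈p∩q⁺ (∈N[]-sym G a∈N[w] , ∈N[]-sym G b∈N[w])) (packing a∈S′ b∈S′ a≢b)
    dominator-unique a∈N[w] _ b∈N[w] _ | inj₁ a∈S′ | inj₂ (_ , refl) =
      contradiction (∈N⟦⟧⁺ G a∈S′ (∈N[]-sym G a∈N[w])) (∈N[v]⇒∉N[S′] (∈N[]-sym G b∈N[w]))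
    dominator-unique a∈N[w] _ b∈N[w] _ | inj₂ (_ , refl) | inj₁ b∈S′ =
      contradiction (∈N⟦⟧⁺ G b∈S′ (∈N[]-sym G b∈N[w])) (∈N[v]⇒∉N[S′] (∈N[]-sym G a∈N[w]))
    dominator-unique a∈N[w] _ b∈N[w] _ | inj₂ (_ , refl) | inj₂ (_ , refl) =
      cong v (common-neighbour⇒≡ (∈N[]-sym G a∈N[w]) (∈N[]-sym G b∈N[w]))

    eds : IsEDS G D
    eds = dominator-unique⇒IsEDS G dominator dominator-unique

lemma1 : ∀ {n p : ℕ} (G : Graph n) (S S′ : Subset n) (C : Fin p → Subset n) →
    AreComponents G (∁ S) C →
    (∀ i → IsTwoClub G (C i)) →
    S′ ⊆ S →
    (∀ {s t} → s ∈ S′ → t ∈ S′ → ¬ (s ≡ t) → ¬ Nonempty (N[_] G s ∩ N[_] G t)) →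
    (∀ i → ¬ (C i ⊆ N⟦_⟧ G S′)) →
    (D : Subset n) →
    (IsEDS G D × D ∩ S ≡ S′)
    ⇔ (Σ (Fin p → Fin n) λ v → (∀ i → v i ∈ C i)
        -- (1) D = S′ ∪ {v₁,…,v_p}, disjoint union (the v_i are distinct and not in S′)
        × D ≡ S′ ∪ image v
        × ¬ Nonempty (S′ ∩ image v)
        × (∀ i j → v i ≡ v j → i ≡ j)
        -- (2) the N[v_i] ∩ U are pairwise disjoint with union U, where U = S ─ N[S′]
        × (∀ i j → ¬ (i ≡ j) →
             ¬ Nonempty ((N[_] G (v i) ∩ (S ─ N⟦_⟧ G S′)) ∩ (N[_] G (v j) ∩ (S ─ N⟦_⟧ G S′))))
        × ⋃ (map (λ i → N[_] G (v i) ∩ (S ─ N⟦_⟧ G S′)) (allFin p)) ≡ S ─ N⟦_⟧ G S′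
        -- (3)
        × (∀ i → C i ⊆ N[_] G (v i) ∪ N⟦_⟧ G S′
                 × ¬ Nonempty (N[_] G (v i) ∩ N⟦_⟧ G S′)))
lemma1 G S S′ C components twoClub S′⊆S packing C⊈N[S′] D = mk⇔ necessity sufficiency
  where
  necessity = λ (eds , D∩S≡S′) →
    let open Necessity G S S′ C components S′⊆S twoClub C⊈N[S′] eds D∩S≡S′
    in v , v∈C , D≡S′∪image , S′∩image-empty , v-injective , N[v]∩U-disjoint , ⋃N[v]∩U≡U
         , λ i → C⊆N[v]∪N[S′] i , N[v]∩N[S′]-empty i
  -- The disjointness and injectivity parts of (1) are consequences, not needed here.
  sufficiency = λ (v , v∈C , D≡S′∪image , _ , _ , N[v]∩U-disjoint , ⋃N[v]∩U≡U , C-dominated) →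
    let open Sufficiency G S S′ C components S′⊆S packing v v∈C D≡S′∪image
                         N[v]∩U-disjoint ⋃N[v]∩U≡U C-dominated
    in eds , D∩S≡S′
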